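{- Let $G$ be a finite-dimensional vector space over $\mathbb{F}_p$ and let $A \subseteq G$ be a subset of density $c$ (i.e. $|A|=c|G|$). Then \begin{align*}&\mathbb{E}_{b_1, b_2, b_3, x_2, y_3, z_1 \in G} 1_{A}(b_1 + b_2 - b_3) 1_{A}(b_1) 1_{A}(b_2) 1_{A}(b_3) 1_{A}(x_2) 1_{A}(x_2 - b_2 + b_3) \\ &\hspace{4cm}1_{A}(y_3) 1_{A}(y_3 + b_1 - b_3) 1_{A}(z_1) 1_{A}(b_1 + b_2 - z_1) \geq c^{32}.\end{align*} -}

module Defs where

open import Data.Nat using (ℕ; zero; suc; NonZero)
import Data.Nat as ℕ
open import Data.Nat.Properties using (m^n≢0)
open import Data.Nat.Primality using (Prime; prime⇒nonZero)
open import Data.Nat.DivMod using (_mod_)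
open import Data.Fin using (Fin; toℕ)
open import Data.Vec using (Vec; []; _∷_; zipWith)
open import Data.List using (List; []; _∷_; map; concatMap; allFin; length; filter)
open import Data.Nat.ListAction using (sum)
open import Data.Bool using (Bool; true; false; if_then_else_; T)
open import Data.Integer using (+_)
open import Data.Rational using (ℚ; _/_; _*_; 1ℚ)

-- Finite-dimensional vector spaces over 𝔽_p (up to isomorphism): 𝔽_p^n,
-- with 𝔽_p = ℤ/pℤ represented as Fin p with arithmetic mod p.
V : ℕ → ℕ → Set
V p n = Vec (Fin p) n

_^ℚ_ : ℚ → ℕ → ℚ
q ^ℚ zero  = 1ℚ
q ^ℚ suc k = q * (q ^ℚ k)

allV : (p n : ℕ) → List (V p n)
allV p zero    = [] ∷ []
allV p (suc n) = concatMap (λ a → map (a ∷_) (allV p n)) (allFin p)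

module _ {p : ℕ} (pr : Prime p) where
  private
    instance
      p≢0 : NonZero p
      p≢0 = prime⇒nonZero pr

  _+F_ : Fin p → Fin p → Fin p
  a +F b = (toℕ a ℕ.+ toℕ b) mod p

  _-F_ : Fin p → Fin p → Fin p
  a -F b = (toℕ a ℕ.+ (p ℕ.∸ toℕ b)) mod p

  _⊕_ : {n : ℕ} → V p n → V p n → V p n
  _⊕_ = zipWith _+F_

  _⊖_ : {n : ℕ} → V p n → V p n → V p n
  _⊖_ = zipWith _-F_

  cardV : ℕ → ℕ
  cardV n = p ℕ.^ n

  cardA : {n : ℕ} → (V p n → Bool) → ℕ
  cardA {n} A = length (filter (λ x → Data.Bool._≟_ (A x) true) (allV p n))

  density : (n : ℕ) → (V p n → Bool) → ℚ
  density n A = (+ cardA A) / cardV n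
    where instance _ : NonZero (p ℕ.^ n)
                   _ = m^n≢0 p n

  𝟙 : {n : ℕ} → (V p n → Bool) → V p n → ℕ
  𝟙 A x = if A x then 1 else 0

  ΣG : (n : ℕ) → (V p n → ℕ) → ℕ
  ΣG n f = sum (map f (allV p n))

  countConfig : (n : ℕ) → (V p n → Bool) → ℕ
  countConfig n A =
    ΣG n λ b₁ → ΣG n λ b₂ → ΣG n λ b₃ → ΣG n λ x₂ → ΣG n λ y₃ → ΣG n λ z₁ →
        𝟙 A ((b₁ ⊕ b₂) ⊖ b₃) ℕ.* 𝟙 A b₁ ℕ.* 𝟙 A b₂ ℕ.* 𝟙 A b₃
      ℕ.* 𝟙 A x₂ ℕ.* 𝟙 A ((x₂ ⊖ b₂) ⊕ b₃)
      ℕ.* 𝟙 A y₃ ℕ.* 𝟙 A ((y₃ ⊕ b₁) ⊖ b₃)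
      ℕ.* 𝟙 A z₁ ℕ.* 𝟙 A ((b₁ ⊕ b₂) ⊖ z₁)

  expectation : (n : ℕ) → (V p n → Bool) → ℚ
  expectation n A = (+ countConfig n A) / ((cardV n) ℕ.^ 6)
    where instance _ : NonZero ((p ℕ.^ n) ℕ.^ 6)
                   _ = m^n≢0 (p ℕ.^ n) 6
                     where instance _ : NonZero (p ℕ.^ n)
                                    _ = m^n≢0 p n

-- Write a = |A|, N = |G|, and r₊(u), r₋(d) for the number of ways to write u = z + z'
-- and d = x' − x with z, z', x, x' ∈ A (sumRep and diffRep below). Summing out z₁ turns
-- the count into Σ_{b₁,b₂} F(b₁,b₂) r₊(b₁ + b₂), where F (frames) counts the remaining
-- eight factors. Since F(b₁,b₂) ≤ 1_A(b₁) 1_A(b₂) r₊(b₁ + b₂) a², Cauchy–Schwarz over the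
-- fibres b₁ + b₂ = v gives (ΣF)² ≤ a⁴ · count. Conversely, the substitution b₁ = b' + d,
-- b₃ = b₂ + d, y₃ = b₃ + k splits a frame into 1_A(x₂) 1_A(x₂ + d) and two copies of
-- 1_A(b) 1_A(b + d) 1_A(b + d + k), so ΣF = Σ_d r₋(d) Σ_k T(d,k)² with
-- T(d,k) = #{b : b, b + d, b + d + k ∈ A} (triples). As Σ_k T(d,k) = a r₋(d) and
-- Σ_d r₋(d) = a², three more applications of Cauchy–Schwarz give a⁸ ≤ N³ ΣF.
-- Together a¹² ≤ N⁶ · count, that is c¹² ≤ 𝔼, which implies c³² ≤ 𝔼 as c ≤ 1.

module Submission where

open import Data.Bool using (Bool; true; false; if_then_else_; _∧_)
import Data.Bool as Bool
open import Data.Fin using (Fin; zero; suc; toℕ)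
import Data.Fin.Properties as Fin
import Data.Integer as ℤ
open import Data.Integer using (+≤+)
open import Data.Integer.Properties using (pos-*)
open import Data.List using (List; []; _∷_; map; concatMap; _++_; tabulate; allFin; length; filter)
open import Data.List.Properties using (map-tabulate; length-tabulate)
open import Data.Nat
open import Data.Nat.DivMod
open import Data.Nat.ListAction using (sum)
open import Data.Nat.Primality using (Prime; prime⇒nonZero)
open import Data.Nat.Properties
open import Algebra.Properties.CommutativeSemigroup +-commutativeSemigroup using (interchange)
open import Data.Nat.Solver using (module +-*-Solver)
open import Data.Nat.Tactic.RingSolver using (solve-∀)
open import Data.Product using (_,_)
import Data.Rational as ℚ
open import Data.Rational using (toℚᵘ)
open import Data.Rational.Properties using (toℚᵘ-fromℚᵘ; toℚᵘ-homo-*; toℚᵘ-cancel-≤)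
open import Data.Rational.Unnormalised using (mkℚᵘ; _≃_; *≤*)
  renaming (_/_ to _ᵘ/_; _*_ to _ᵘ*_; _≤_ to _≤ᵘ_)
open import Data.Rational.Unnormalised.Properties
  using (≃-refl; ≃-sym; ≃-trans; ≃-reflexive; ≤-respˡ-≃; ≤-respʳ-≃)
  renaming (*-cong to ᵘ*-cong)
open import Data.Sum using (inj₁; inj₂)
open import Data.Vec using (Vec; []; _∷_; zipWith)
open import Data.Vec.Properties using (≡-dec)
open import Data.Vec.Relation.Binary.Pointwise.Inductive
  using (Pointwise-≡⇒≡; zipWith-comm; zipWith-assoc)
open import Function using (_∘_)
open import Relation.Binary.Definitions using (DecidableEquality)
open import Relation.Binary.PropositionalEquality
open import Relation.Nullary using (¬_; yes; no; does)
open import Relation.Nullary.Decidable using (dec-true; dec-false)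

open import Defs

private
  variable
    X Y : Set

∑ : List X → (X → ℕ) → ℕ
∑ xs f = sum (map f xs)

module _ {X : Set} where

  ∑-cong : (xs : List X) {f g : X → ℕ} → (∀ x → f x ≡ g x) → ∑ xs f ≡ ∑ xs g
  ∑-cong []       f≡g = refl
  ∑-cong (x ∷ xs) f≡g = cong₂ _+_ (f≡g x) (∑-cong xs f≡g)

  ∑-zero : (xs : List X) → ∑ xs (λ _ → 0) ≡ 0
  ∑-zero []       = refl
  ∑-zero (x ∷ xs) = ∑-zero xs

  ∑-+ : (xs : List X) (f g : X → ℕ) → ∑ xs (λ x → f x + g x) ≡ ∑ xs f + ∑ xs g
  ∑-+ []       f g = refl
  ∑-+ (x ∷ xs) f g rewrite ∑-+ xs f g = interchange (f x) (g x) (∑ xs f) (∑ xs g)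

  ∑-*ˡ : (xs : List X) (c : ℕ) (f : X → ℕ) → ∑ xs (λ x → c * f x) ≡ c * ∑ xs f
  ∑-*ˡ []       c f = sym (*-zeroʳ c)
  ∑-*ˡ (x ∷ xs) c f rewrite ∑-*ˡ xs c f = sym (*-distribˡ-+ c (f x) (∑ xs f))

  ∑-*ʳ : (xs : List X) (c : ℕ) (f : X → ℕ) → ∑ xs (λ x → f x * c) ≡ ∑ xs f * c
  ∑-*ʳ xs c f = begin
    ∑ xs (λ x → f x * c) ≡⟨ ∑-cong xs (λ x → *-comm (f x) c) ⟩
    ∑ xs (λ x → c * f x) ≡⟨ ∑-*ˡ xs c f ⟩
    c * ∑ xs f           ≡⟨ *-comm c (∑ xs f) ⟩
    ∑ xs f * c ∎
    where open ≡-Reasoning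

  ∑-const : (xs : List X) (c : ℕ) → ∑ xs (λ _ → c) ≡ length xs * c
  ∑-const []       c = refl
  ∑-const (x ∷ xs) c = cong (c +_) (∑-const xs c)

  ∑-mono-≤ : (xs : List X) {f g : X → ℕ} → (∀ x → f x ≤ g x) → ∑ xs f ≤ ∑ xs g
  ∑-mono-≤ []       f≤g = z≤n
  ∑-mono-≤ (x ∷ xs) f≤g = +-mono-≤ (f≤g x) (∑-mono-≤ xs f≤g)

  ∑-++ : (xs ys : List X) (f : X → ℕ) → ∑ (xs ++ ys) f ≡ ∑ xs f + ∑ ys f
  ∑-++ []       ys f = refl
  ∑-++ (x ∷ xs) ys f rewrite ∑-++ xs ys f = sym (+-assoc (f x) (∑ xs f) (∑ ys f))

∑-comm : (xs : List X) (ys : List Y) (F : X → Y → ℕ) →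
         ∑ xs (λ x → ∑ ys (F x)) ≡ ∑ ys (λ y → ∑ xs (λ x → F x y))
∑-comm []       ys F = sym (∑-zero ys)
∑-comm (x ∷ xs) ys F rewrite ∑-comm xs ys F = sym (∑-+ ys (F x) (λ y → ∑ xs (λ x → F x y)))

∑-*-∑ : (xs : List X) (ys : List Y) (f : X → ℕ) (g : Y → ℕ) →
        ∑ xs (λ x → ∑ ys (λ y → f x * g y)) ≡ ∑ xs f * ∑ ys g
∑-*-∑ xs ys f g = trans (∑-cong xs (λ x → ∑-*ˡ ys (f x) g)) (∑-*ʳ xs (∑ ys g) f)

∑-map : (g : X → Y) (xs : List X) (f : Y → ℕ) → ∑ (map g xs) f ≡ ∑ xs (f ∘ g)
∑-map g []       f = refl
∑-map g (x ∷ xs) f = cong (f (g x) +_) (∑-map g xs f)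

∑-concatMap : (g : X → List Y) (xs : List X) (f : Y → ℕ) →
              ∑ (concatMap g xs) f ≡ ∑ xs (λ x → ∑ (g x) f)
∑-concatMap g []       f = refl
∑-concatMap g (x ∷ xs) f =
  trans (∑-++ (g x) (concatMap g xs) f) (cong (∑ (g x) f +_) (∑-concatMap g xs f))

m*m≤n*n⇒m≤n : ∀ {m n} → m * m ≤ n * n → m ≤ n
m*m≤n*n⇒m≤n m*m≤n*n = ≮⇒≥ (λ n<m → <⇒≱ (*-mono-< n<m n<m) m*m≤n*n)

x≤y⇒4xy≤[x+y]² : ∀ {x y} → x ≤ y → 4 * (x * y) ≤ (x + y) * (x + y)
x≤y⇒4xy≤[x+y]² {x} x≤y with m≤n⇒∃[o]m+o≡n x≤y
... | t , refl = ≤-trans (m≤m+n _ (t * t)) (≤-reflexive (square x t))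
  where
  square : ∀ x t → 4 * (x * (x + t)) + t * t ≡ (x + (x + t)) * (x + (x + t))
  square = solve-∀

4xy≤[x+y]² : ∀ x y → 4 * (x * y) ≤ (x + y) * (x + y)
4xy≤[x+y]² x y with ≤-total x y
... | inj₁ x≤y = x≤y⇒4xy≤[x+y]² x≤y
... | inj₂ y≤x = subst₂ (λ u v → 4 * u ≤ v * v) (*-comm y x) (+-comm y x) (x≤y⇒4xy≤[x+y]² y≤x)

x*x≤y*z⇒2x≤y+z : ∀ {x y z} → x * x ≤ y * z → 2 * x ≤ y + z
x*x≤y*z⇒2x≤y+z {x} {y} {z} x*x≤y*z = m*m≤n*n⇒m≤n (begin
  2 * x * (2 * x)   ≡⟨ [2x]²≡4x² x ⟩
  4 * (x * x)       ≤⟨ *-monoʳ-≤ 4 x*x≤y*z ⟩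
  4 * (y * z)       ≤⟨ 4xy≤[x+y]² y z ⟩
  (y + z) * (y + z) ∎)
  where
  open ≤-Reasoning
  [2x]²≡4x² : ∀ x → 2 * x * (2 * x) ≡ 4 * (x * x)
  [2x]²≡4x² = solve-∀

∑-cauchy-schwarz : (xs : List X) (f g h : X → ℕ) → (∀ x → f x * f x ≤ g x * h x) →
                   ∑ xs f * ∑ xs f ≤ ∑ xs g * ∑ xs h
∑-cauchy-schwarz []       f g h f²≤gh = z≤n
∑-cauchy-schwarz (x ∷ xs) f g h f²≤gh = begin
  (f₀ + F) * (f₀ + F)                    ≡⟨ expand f₀ F ⟩
  f₀ * f₀ + 2 * (f₀ * F) + F * F         ≤⟨ +-mono-≤ (+-mono-≤ (f²≤gh x) cross) ih ⟩
  g₀ * h₀ + (g₀ * H + h₀ * G) + G * H    ≡⟨ collect g₀ h₀ G H ⟩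
  (g₀ + G) * (h₀ + H) ∎
  where
  open ≤-Reasoning
  f₀ = f x ; g₀ = g x ; h₀ = h x
  F = ∑ xs f ; G = ∑ xs g ; H = ∑ xs h
  ih : F * F ≤ G * H
  ih = ∑-cauchy-schwarz xs f g h f²≤gh
  expand : ∀ u v → (u + v) * (u + v) ≡ u * u + 2 * (u * v) + v * v
  expand = solve-∀
  collect : ∀ g₀ h₀ G H → g₀ * h₀ + (g₀ * H + h₀ * G) + G * H ≡ (g₀ + G) * (h₀ + H)
  collect = solve-∀
  regroup₁ : ∀ f₀ F → f₀ * F * (f₀ * F) ≡ f₀ * f₀ * (F * F)
  regroup₁ = solve-∀
  regroup₂ : ∀ g₀ h₀ G H → g₀ * h₀ * (G * H) ≡ g₀ * H * (h₀ * G)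
  regroup₂ = solve-∀
  cross : 2 * (f₀ * F) ≤ g₀ * H + h₀ * G
  cross = x*x≤y*z⇒2x≤y+z {f₀ * F} {g₀ * H} {h₀ * G} (begin
    f₀ * F * (f₀ * F)   ≡⟨ regroup₁ f₀ F ⟩
    f₀ * f₀ * (F * F)   ≤⟨ *-mono-≤ (f²≤gh x) ih ⟩
    g₀ * h₀ * (G * H)   ≡⟨ regroup₂ g₀ h₀ G H ⟩
    g₀ * H * (h₀ * G) ∎)

∑-square-≤ : (xs : List X) (f : X → ℕ) →
             ∑ xs f * ∑ xs f ≤ ∑ xs (λ _ → 1) * ∑ xs (λ x → f x * f x)
∑-square-≤ xs f =
  ∑-cauchy-schwarz xs f (λ _ → 1) (λ x → f x * f x) (λ x → ≤-reflexive (sym (*-identityˡ _)))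

module _ {X : Set} (_≟_ : DecidableEquality X) where

  δ : X → X → ℕ
  δ x y = if does (x ≟ y) then 1 else 0

  δ-≡ : ∀ {x y} → x ≡ y → δ x y ≡ 1
  δ-≡ {x} {y} x≡y rewrite dec-true (x ≟ y) x≡y = refl

  δ-≢ : ∀ {x y} → ¬ x ≡ y → δ x y ≡ 0
  δ-≢ {x} {y} x≢y rewrite dec-false (x ≟ y) x≢y = refl

  δ-resp-⇔ : ∀ {x y u v} → (x ≡ y → u ≡ v) → (u ≡ v → x ≡ y) → δ x y ≡ δ u v
  δ-resp-⇔ {x} {y} to from with x ≟ y
  ... | yes x≡y = sym (δ-≡ (to x≡y))
  ... | no  x≢y = sym (δ-≢ (x≢y ∘ from))

  δ-* : ∀ x y (f : X → ℕ) → δ x y * f y ≡ δ x y * f x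
  δ-* x y f with x ≟ y
  ... | yes refl = refl
  ... | no  x≢y  = refl

  Enumerates : List X → Set
  Enumerates xs = ∀ x → ∑ xs (δ x) ≡ 1

  module _ {xs : List X} (enum : Enumerates xs) where

    ∑-δ : ∀ x (f : X → ℕ) → ∑ xs (λ y → δ x y * f y) ≡ f x
    ∑-δ x f = begin
      ∑ xs (λ y → δ x y * f y) ≡⟨ ∑-cong xs (λ y → δ-* x y f) ⟩
      ∑ xs (λ y → δ x y * f x) ≡⟨ ∑-*ʳ xs (f x) (δ x) ⟩
      ∑ xs (δ x) * f x         ≡⟨ cong (_* f x) (enum x) ⟩
      1 * f x                  ≡⟨ *-identityˡ (f x) ⟩
      f x ∎
      where open ≡-Reasoning

    ∑-reindex : (τ σ : X → X) → (∀ x → σ (τ x) ≡ x) → (∀ y → τ (σ y) ≡ y) →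
                (f : X → ℕ) → ∑ xs (λ x → f (τ x)) ≡ ∑ xs f
    ∑-reindex τ σ στ τσ f = begin
      ∑ xs (λ x → f (τ x))
        ≡⟨ ∑-cong xs (λ x → sym (∑-δ (τ x) f)) ⟩
      ∑ xs (λ x → ∑ xs (λ y → δ (τ x) y * f y))
        ≡⟨ ∑-comm xs xs _ ⟩
      ∑ xs (λ y → ∑ xs (λ x → δ (τ x) y * f y))
        ≡⟨ ∑-cong xs (λ y → ∑-*ʳ xs (f y) (λ x → δ (τ x) y)) ⟩
      ∑ xs (λ y → ∑ xs (λ x → δ (τ x) y) * f y)
        ≡⟨ ∑-cong xs (λ y → cong (_* f y) (fibre y)) ⟩
      ∑ xs (λ y → 1 * f y)
        ≡⟨ ∑-cong xs (λ y → *-identityˡ (f y)) ⟩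
      ∑ xs f ∎
      where
      open ≡-Reasoning
      fibre : ∀ y → ∑ xs (λ x → δ (τ x) y) ≡ 1
      fibre y = trans (∑-cong xs (λ x → δ-resp-⇔ (λ τx≡y → trans (sym (cong σ τx≡y)) (στ x))
                                                  (λ σy≡x → trans (sym (cong τ σy≡x)) (τσ y))))
                      (enum (σ y))

a³²N⁶≤M*N³² : ∀ {a N Q S W M} → a ≤ N →
              a * a * (a * a) ≤ N * Q → Q * Q ≤ a * a * S → a * a * S ≤ N * W →
              W * W ≤ a * a * (a * a) * M → a ^ 32 * N ^ 6 ≤ M * N ^ 32
a³²N⁶≤M*N³² {a} {N} {Q} {S} {W} {M} a≤N h₁ h₂ h₃ h₄ = begin
  a ^ 32 * N ^ 6
    ≡⟨ solve 2 (λ a N → a :^ 32 :* N :^ 6 := a :^ 16 :* a :^ 16 :* N :^ 6) refl a N ⟩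
  a ^ 16 * a ^ 16 * N ^ 6
    ≤⟨ *-monoˡ-≤ (N ^ 6) (*-monoʳ-≤ (a ^ 16) a¹⁶≤a⁴N⁶M) ⟩
  a ^ 16 * (a ^ 4 * N ^ 6 * M) * N ^ 6
    ≡⟨ solve 3 (λ a N M → a :^ 16 :* (a :^ 4 :* N :^ 6 :* M) :* N :^ 6 := a :^ 20 :* (N :^ 12 :* M))
               refl a N M ⟩
  a ^ 20 * (N ^ 12 * M)
    ≤⟨ *-monoˡ-≤ (N ^ 12 * M) (^-monoˡ-≤ 20 a≤N) ⟩
  N ^ 20 * (N ^ 12 * M)
    ≡⟨ solve 2 (λ N M → N :^ 20 :* (N :^ 12 :* M) := M :* N :^ 32) refl N M ⟩
  M * N ^ 32 ∎
  where
  open ≤-Reasoning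
  open +-*-Solver
  a⁸≤N³W : a ^ 8 ≤ N ^ 3 * W
  a⁸≤N³W = begin
    a ^ 8
      ≡⟨ solve 1 (λ a → a :^ 8 := a :* a :* (a :* a) :* (a :* a :* (a :* a))) refl a ⟩
    a * a * (a * a) * (a * a * (a * a))
      ≤⟨ *-mono-≤ h₁ h₁ ⟩
    N * Q * (N * Q)
      ≡⟨ solve 2 (λ N Q → N :* Q :* (N :* Q) := N :* N :* (Q :* Q)) refl N Q ⟩
    N * N * (Q * Q)
      ≤⟨ *-monoʳ-≤ (N * N) (≤-trans h₂ h₃) ⟩
    N * N * (N * W)
      ≡⟨ solve 2 (λ N W → N :* N :* (N :* W) := N :^ 3 :* W) refl N W ⟩
    N ^ 3 * W ∎
  a¹⁶≤a⁴N⁶M : a ^ 16 ≤ a ^ 4 * N ^ 6 * M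
  a¹⁶≤a⁴N⁶M = begin
    a ^ 16
      ≡⟨ solve 1 (λ a → a :^ 16 := a :^ 8 :* a :^ 8) refl a ⟩
    a ^ 8 * a ^ 8
      ≤⟨ *-mono-≤ a⁸≤N³W a⁸≤N³W ⟩
    N ^ 3 * W * (N ^ 3 * W)
      ≡⟨ solve 2 (λ N W → N :^ 3 :* W :* (N :^ 3 :* W) := N :^ 6 :* (W :* W)) refl N W ⟩
    N ^ 6 * (W * W)
      ≤⟨ *-monoʳ-≤ (N ^ 6) h₄ ⟩
    N ^ 6 * (a * a * (a * a) * M)
      ≡⟨ solve 3 (λ N a M → N :^ 6 :* (a :* a :* (a :* a) :* M) := a :^ 4 :* N :^ 6 :* M) refl N a M ⟩
    a ^ 4 * N ^ 6 * M ∎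

module Configurations
  {G : Set} (_≟_ : DecidableEquality G) (elements : List G) (enum : Enumerates _≟_ elements)
  (_⊕_ _⊖_ : G → G → G)
  (⊕-comm : ∀ x y → x ⊕ y ≡ y ⊕ x)
  (⊕-assoc : ∀ x y z → (x ⊕ y) ⊕ z ≡ x ⊕ (y ⊕ z))
  (x⊕y⊖y≡x : ∀ x y → (x ⊕ y) ⊖ y ≡ x)
  (x⊖y⊕y≡x : ∀ x y → (x ⊖ y) ⊕ y ≡ x)
  (A : G → Bool)
  where

  ∑G : (G → ℕ) → ℕ
  ∑G = ∑ elements

  infix 1 ∑G
  syntax ∑G (λ x → e) = ∑[ x ] e

  ∑G-cong : {f g : G → ℕ} → (∀ x → f x ≡ g x) → ∑G f ≡ ∑G g
  ∑G-cong = ∑-cong elements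

  ∑G-comm : (F : G → G → ℕ) → (∑[ x ] ∑[ y ] F x y) ≡ (∑[ y ] ∑[ x ] F x y)
  ∑G-comm = ∑-comm elements elements

  ∑G-translateʳ : ∀ c (f : G → ℕ) → (∑[ x ] f (x ⊕ c)) ≡ ∑G f
  ∑G-translateʳ c =
    ∑-reindex _≟_ {elements} enum (_⊕ c) (_⊖ c) (λ x → x⊕y⊖y≡x x c) (λ y → x⊖y⊕y≡x y c)

  ∑G-translateˡ : ∀ c (f : G → ℕ) → (∑[ x ] f (c ⊕ x)) ≡ ∑G f
  ∑G-translateˡ c f = trans (∑G-cong (λ x → cong f (⊕-comm c x))) (∑G-translateʳ c f)

  ∑G-translate⁻ : ∀ c (f : G → ℕ) → (∑[ x ] f (x ⊖ c)) ≡ ∑G f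
  ∑G-translate⁻ c =
    ∑-reindex _≟_ {elements} enum (_⊖ c) (_⊕ c) (λ x → x⊖y⊕y≡x x c) (λ y → x⊕y⊖y≡x y c)

  x⊕[y⊖x]≡y : ∀ x y → x ⊕ (y ⊖ x) ≡ y
  x⊕[y⊖x]≡y x y = trans (⊕-comm x (y ⊖ x)) (x⊖y⊕y≡x y x)

  x⊕y⊕z⊖[z⊕y]≡x : ∀ x y z → ((x ⊕ y) ⊕ z) ⊖ (z ⊕ y) ≡ x
  x⊕y⊕z⊖[z⊕y]≡x x y z = begin
    ((x ⊕ y) ⊕ z) ⊖ (z ⊕ y) ≡⟨ cong (_⊖ (z ⊕ y)) (⊕-assoc x y z) ⟩
    (x ⊕ (y ⊕ z)) ⊖ (z ⊕ y) ≡⟨ cong (λ w → (x ⊕ w) ⊖ (z ⊕ y)) (⊕-comm y z) ⟩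
    (x ⊕ (z ⊕ y)) ⊖ (z ⊕ y) ≡⟨ x⊕y⊖y≡x x (z ⊕ y) ⟩
    x ∎
    where open ≡-Reasoning

  [x⊖y]⊕[y⊕z]≡x⊕z : ∀ x y z → (x ⊖ y) ⊕ (y ⊕ z) ≡ x ⊕ z
  [x⊖y]⊕[y⊕z]≡x⊕z x y z = trans (sym (⊕-assoc (x ⊖ y) y z)) (cong (_⊕ z) (x⊖y⊕y≡x x y))

  x⊕y⊕z⊖x≡z⊕y : ∀ x y z → ((x ⊕ y) ⊕ z) ⊖ x ≡ z ⊕ y
  x⊕y⊕z⊖x≡z⊕y x y z = begin
    ((x ⊕ y) ⊕ z) ⊖ x ≡⟨ cong (_⊖ x) (trans (⊕-assoc x y z) (⊕-comm x (y ⊕ z))) ⟩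
    ((y ⊕ z) ⊕ x) ⊖ x ≡⟨ x⊕y⊖y≡x (y ⊕ z) x ⟩
    y ⊕ z             ≡⟨ ⊕-comm y z ⟩
    z ⊕ y ∎
    where open ≡-Reasoning

  χ : G → ℕ
  χ x = if A x then 1 else 0

  χ≤1 : ∀ x → χ x ≤ 1
  χ≤1 x with A x
  ... | true  = ≤-refl
  ... | false = z≤n

  a N : ℕ
  a = ∑G χ
  N = ∑[ _ ] 1

  a≤N : a ≤ N
  a≤N = ∑-mono-≤ elements χ≤1

  ∑χ*χ∘φ≡a*a : (φ : G → G → G) → (∀ z → (∑[ u ] χ (φ z u)) ≡ a) →
               (∑[ u ] ∑[ z ] χ z * χ (φ z u)) ≡ a * a
  ∑χ*χ∘φ≡a*a φ ∑χ∘φ≡a = begin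
    (∑[ u ] ∑[ z ] χ z * χ (φ z u))
      ≡⟨ ∑G-comm _ ⟩
    (∑[ z ] ∑[ u ] χ z * χ (φ z u))
      ≡⟨ ∑G-cong (λ z → trans (∑-*ˡ elements (χ z) _) (cong (χ z *_) (∑χ∘φ≡a z))) ⟩
    (∑[ z ] χ z * a)
      ≡⟨ ∑-*ʳ elements a χ ⟩
    a * a ∎
    where open ≡-Reasoning

  sumRep : G → ℕ
  sumRep u = ∑[ z ] χ z * χ (u ⊖ z)

  ∑sumRep≡a*a : ∑G sumRep ≡ a * a
  ∑sumRep≡a*a = ∑χ*χ∘φ≡a*a (λ z u → u ⊖ z) (λ z → ∑G-translate⁻ z χ)

  diffRep : G → ℕ
  diffRep d = ∑[ x ] χ x * χ (x ⊕ d)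

  ∑diffRep≡a*a : ∑G diffRep ≡ a * a
  ∑diffRep≡a*a = ∑χ*χ∘φ≡a*a _⊕_ (λ x → ∑G-translateˡ x χ)

  -- The factors are ordered as in countConfig, so that count unfolds to it for G = 𝔽ₚⁿ.
  frame : G → G → G → G → G → ℕ
  frame b₁ b₂ b₃ x₂ y₃ =
      χ ((b₁ ⊕ b₂) ⊖ b₃) * χ b₁ * χ b₂ * χ b₃
    * χ x₂ * χ ((x₂ ⊖ b₂) ⊕ b₃) * χ y₃ * χ ((y₃ ⊕ b₁) ⊖ b₃)

  count : ℕ
  count = ∑[ b₁ ] ∑[ b₂ ] ∑[ b₃ ] ∑[ x₂ ] ∑[ y₃ ] ∑[ z₁ ]
            frame b₁ b₂ b₃ x₂ y₃ * χ z₁ * χ ((b₁ ⊕ b₂) ⊖ z₁)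

  frames : G → G → ℕ
  frames b₁ b₂ = ∑[ b₃ ] ∑[ x₂ ] ∑[ y₃ ] frame b₁ b₂ b₃ x₂ y₃

  frameCount : ℕ
  frameCount = ∑[ b₁ ] ∑[ b₂ ] frames b₁ b₂

  ∑∑∑-*ʳ : (F : G → G → G → ℕ) (c : ℕ) →
           (∑[ x ] ∑[ y ] ∑[ z ] F x y z * c) ≡ (∑[ x ] ∑[ y ] ∑[ z ] F x y z) * c
  ∑∑∑-*ʳ F c = begin
    (∑[ x ] ∑[ y ] ∑[ z ] F x y z * c)
      ≡⟨ ∑G-cong (λ x → ∑G-cong (λ y → ∑-*ʳ elements c (F x y))) ⟩
    (∑[ x ] ∑[ y ] (∑[ z ] F x y z) * c)
      ≡⟨ ∑G-cong (λ x → ∑-*ʳ elements c _) ⟩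
    (∑[ x ] (∑[ y ] ∑[ z ] F x y z) * c)
      ≡⟨ ∑-*ʳ elements c _ ⟩
    (∑[ x ] ∑[ y ] ∑[ z ] F x y z) * c ∎
    where open ≡-Reasoning

  count≡∑frames*sumRep : count ≡ (∑[ b₁ ] ∑[ b₂ ] frames b₁ b₂ * sumRep (b₁ ⊕ b₂))
  count≡∑frames*sumRep = ∑G-cong λ b₁ → ∑G-cong λ b₂ → begin
    (∑[ b₃ ] ∑[ x₂ ] ∑[ y₃ ] ∑[ z₁ ] frame b₁ b₂ b₃ x₂ y₃ * χ z₁ * χ ((b₁ ⊕ b₂) ⊖ z₁))
      ≡⟨ ∑G-cong (λ b₃ → ∑G-cong λ x₂ → ∑G-cong λ y₃ →
                    factor (frame b₁ b₂ b₃ x₂ y₃) (b₁ ⊕ b₂)) ⟩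
    (∑[ b₃ ] ∑[ x₂ ] ∑[ y₃ ] frame b₁ b₂ b₃ x₂ y₃ * sumRep (b₁ ⊕ b₂))
      ≡⟨ ∑∑∑-*ʳ (frame b₁ b₂) (sumRep (b₁ ⊕ b₂)) ⟩
    frames b₁ b₂ * sumRep (b₁ ⊕ b₂) ∎
    where
    open ≡-Reasoning
    factor : ∀ c u → (∑[ z ] c * χ z * χ (u ⊖ z)) ≡ c * sumRep u
    factor c u = trans (∑G-cong (λ z → *-assoc c (χ z) (χ (u ⊖ z)))) (∑-*ˡ elements c _)

  frame≤ : ∀ b₁ b₂ b₃ x₂ y₃ → frame b₁ b₂ b₃ x₂ y₃ ≤
           χ b₁ * χ b₂ * (χ b₃ * χ ((b₁ ⊕ b₂) ⊖ b₃)) * (χ x₂ * χ y₃)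
  frame≤ b₁ b₂ b₃ x₂ y₃ = begin
    frame b₁ b₂ b₃ x₂ y₃
      ≡⟨ regroup (χ ((b₁ ⊕ b₂) ⊖ b₃)) (χ b₁) (χ b₂) (χ b₃) (χ x₂) _ (χ y₃) _ ⟩
    kept * (χ ((x₂ ⊖ b₂) ⊕ b₃) * χ ((y₃ ⊕ b₁) ⊖ b₃))
      ≤⟨ *-monoʳ-≤ kept (*-mono-≤ (χ≤1 _) (χ≤1 _)) ⟩
    kept * 1
      ≡⟨ *-identityʳ kept ⟩
    kept ∎
    where
    open ≤-Reasoning
    kept = χ b₁ * χ b₂ * (χ b₃ * χ ((b₁ ⊕ b₂) ⊖ b₃)) * (χ x₂ * χ y₃)
    regroup : ∀ u₁ u₂ u₃ u₄ u₅ u₆ u₇ u₈ → u₁ * u₂ * u₃ * u₄ * u₅ * u₆ * u₇ * u₈ ≡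
                                          u₂ * u₃ * (u₄ * u₁) * (u₅ * u₇) * (u₆ * u₈)
    regroup = solve-∀

  frames≤ : ∀ b₁ b₂ → frames b₁ b₂ ≤ χ b₁ * χ b₂ * sumRep (b₁ ⊕ b₂) * (a * a)
  frames≤ b₁ b₂ = begin
    frames b₁ b₂
      ≤⟨ ∑-mono-≤ elements (λ b₃ → ∑-mono-≤ elements λ x₂ → ∑-mono-≤ elements λ y₃ →
                              frame≤ b₁ b₂ b₃ x₂ y₃) ⟩
    (∑[ b₃ ] ∑[ x₂ ] ∑[ y₃ ] pair b₃ * (χ x₂ * χ y₃))
      ≡⟨ ∑G-cong (λ b₃ → trans (∑G-cong λ x₂ → ∑-*ˡ elements (pair b₃) _)
                               (∑-*ˡ elements (pair b₃) _)) ⟩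
    (∑[ b₃ ] pair b₃ * (∑[ x₂ ] ∑[ y₃ ] χ x₂ * χ y₃))
      ≡⟨ ∑G-cong (λ b₃ → cong (pair b₃ *_) (∑-*-∑ elements elements χ χ)) ⟩
    (∑[ b₃ ] pair b₃ * (a * a))
      ≡⟨ ∑-*ʳ elements (a * a) pair ⟩
    ∑G pair * (a * a)
      ≡⟨ cong (_* (a * a)) (∑-*ˡ elements (χ b₁ * χ b₂) _) ⟩
    χ b₁ * χ b₂ * sumRep (b₁ ⊕ b₂) * (a * a) ∎
    where
    open ≤-Reasoning
    pair : G → ℕ
    pair b₃ = χ b₁ * χ b₂ * (χ b₃ * χ ((b₁ ⊕ b₂) ⊖ b₃))

  framesOver : G → ℕ
  framesOver v = ∑[ b₁ ] frames b₁ (v ⊖ b₁)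

  ∑framesOver≡frameCount : ∑G framesOver ≡ frameCount
  ∑framesOver≡frameCount =
    trans (∑G-comm _) (∑G-cong (λ b₁ → ∑G-translate⁻ b₁ (frames b₁)))

  ∑sumRep*framesOver≡count : (∑[ v ] sumRep v * framesOver v) ≡ count
  ∑sumRep*framesOver≡count = begin
    (∑[ v ] sumRep v * framesOver v)
      ≡⟨ ∑G-cong (λ v → sym (∑-*ˡ elements (sumRep v) _)) ⟩
    (∑[ v ] ∑[ b₁ ] sumRep v * frames b₁ (v ⊖ b₁))
      ≡⟨ ∑G-comm _ ⟩
    (∑[ b₁ ] ∑[ v ] sumRep v * frames b₁ (v ⊖ b₁))
      ≡⟨ ∑G-cong (λ b₁ → sym (∑G-translateʳ b₁ _)) ⟩
    (∑[ b₁ ] ∑[ b₂ ] sumRep (b₂ ⊕ b₁) * frames b₁ ((b₂ ⊕ b₁) ⊖ b₁))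
      ≡⟨ ∑G-cong (λ b₁ → ∑G-cong λ b₂ → untranslate b₁ b₂) ⟩
    (∑[ b₁ ] ∑[ b₂ ] frames b₁ b₂ * sumRep (b₁ ⊕ b₂))
      ≡⟨ count≡∑frames*sumRep ⟨
    count ∎
    where
    open ≡-Reasoning
    untranslate : ∀ b₁ b₂ → sumRep (b₂ ⊕ b₁) * frames b₁ ((b₂ ⊕ b₁) ⊖ b₁) ≡
                            frames b₁ b₂ * sumRep (b₁ ⊕ b₂)
    untranslate b₁ b₂ rewrite x⊕y⊖y≡x b₂ b₁ | ⊕-comm b₂ b₁ =
      *-comm (sumRep (b₁ ⊕ b₂)) (frames b₁ b₂)

  framesOver≤ : ∀ v → framesOver v ≤ a * a * sumRep v * sumRep v
  framesOver≤ v = begin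
    framesOver v
      ≤⟨ ∑-mono-≤ elements (λ b₁ → frames≤ b₁ (v ⊖ b₁)) ⟩
    (∑[ b₁ ] χ b₁ * χ (v ⊖ b₁) * sumRep (b₁ ⊕ (v ⊖ b₁)) * (a * a))
      ≡⟨ ∑G-cong (λ b₁ → cong (λ w → χ b₁ * χ (v ⊖ b₁) * sumRep w * (a * a))
                              (x⊕[y⊖x]≡y b₁ v)) ⟩
    (∑[ b₁ ] χ b₁ * χ (v ⊖ b₁) * sumRep v * (a * a))
      ≡⟨ ∑G-cong (λ b₁ → regroup (χ b₁ * χ (v ⊖ b₁)) (sumRep v) (a * a)) ⟩
    (∑[ b₁ ] χ b₁ * χ (v ⊖ b₁) * (a * a * sumRep v))
      ≡⟨ ∑-*ʳ elements (a * a * sumRep v) _ ⟩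
    sumRep v * (a * a * sumRep v)
      ≡⟨ *-comm (sumRep v) (a * a * sumRep v) ⟩
    a * a * sumRep v * sumRep v ∎
    where
    open ≤-Reasoning
    regroup : ∀ x r c → x * r * c ≡ x * (c * r)
    regroup = solve-∀

  frameCount²≤a⁴*count : frameCount * frameCount ≤ a * a * (a * a) * count
  frameCount²≤a⁴*count = begin
    frameCount * frameCount
      ≡⟨ cong₂ _*_ ∑framesOver≡frameCount ∑framesOver≡frameCount ⟨
    ∑G framesOver * ∑G framesOver
      ≤⟨ ∑-cauchy-schwarz elements framesOver (λ v → a * a * sumRep v) (λ v → sumRep v * framesOver v)
                          pointwise ⟩
    (∑[ v ] a * a * sumRep v) * (∑[ v ] sumRep v * framesOver v)
      ≡⟨ cong₂ _*_ (trans (∑-*ˡ elements (a * a) sumRep) (cong (a * a *_) ∑sumRep≡a*a))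
                   ∑sumRep*framesOver≡count ⟩
    a * a * (a * a) * count ∎
    where
    open ≤-Reasoning
    pointwise : ∀ v → framesOver v * framesOver v ≤ a * a * sumRep v * (sumRep v * framesOver v)
    pointwise v = ≤-trans (*-monoˡ-≤ (framesOver v) (framesOver≤ v))
                          (≤-reflexive (*-assoc (a * a * sumRep v) (sumRep v) (framesOver v)))

  triple : G → G → G → ℕ
  triple d k b = χ b * χ (b ⊕ d) * χ ((b ⊕ d) ⊕ k)

  triples : G → G → ℕ
  triples d k = ∑G (triple d k)

  ∑triples² : G → ℕ
  ∑triples² d = ∑[ k ] triples d k * triples d k

  ∑triples≡diffRep*a : ∀ d → ∑G (triples d) ≡ diffRep d * a
  ∑triples≡diffRep*a d = begin
    (∑[ k ] ∑[ b ] χ b * χ (b ⊕ d) * χ ((b ⊕ d) ⊕ k))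
      ≡⟨ ∑G-comm _ ⟩
    (∑[ b ] ∑[ k ] χ b * χ (b ⊕ d) * χ ((b ⊕ d) ⊕ k))
      ≡⟨ ∑G-cong (λ b → ∑-*ˡ elements (χ b * χ (b ⊕ d)) _) ⟩
    (∑[ b ] χ b * χ (b ⊕ d) * (∑[ k ] χ ((b ⊕ d) ⊕ k)))
      ≡⟨ ∑G-cong (λ b → cong (χ b * χ (b ⊕ d) *_) (∑G-translateˡ (b ⊕ d) χ)) ⟩
    (∑[ b ] χ b * χ (b ⊕ d) * a)
      ≡⟨ ∑-*ʳ elements a _ ⟩
    diffRep d * a ∎
    where open ≡-Reasoning

  frame-shear : ∀ d k b' b x → frame (b' ⊕ d) b (b ⊕ d) x ((b ⊕ d) ⊕ k) ≡
                χ x * χ (x ⊕ d) * (triple d k b' * triple d k b)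
  frame-shear d k b' b x
    rewrite x⊕y⊕z⊖[z⊕y]≡x b' d b | [x⊖y]⊕[y⊕z]≡x⊕z x b d | x⊕y⊕z⊖x≡z⊕y (b ⊕ d) k (b' ⊕ d) =
    regroup (χ b') (χ (b' ⊕ d)) (χ b) (χ (b ⊕ d)) (χ x) (χ (x ⊕ d))
            (χ ((b ⊕ d) ⊕ k)) (χ ((b' ⊕ d) ⊕ k))
    where
    regroup : ∀ u₁ u₂ u₃ u₄ u₅ u₆ u₇ u₈ → u₁ * u₂ * u₃ * u₄ * u₅ * u₆ * u₇ * u₈ ≡
                                          u₅ * u₆ * (u₁ * u₂ * u₈ * (u₃ * u₄ * u₇))
    regroup = solve-∀

  frameCount≡∑sheared :
    frameCount ≡ (∑[ d ] ∑[ k ] ∑[ b' ] ∑[ b ] ∑[ x ] frame (b' ⊕ d) b (b ⊕ d) x ((b ⊕ d) ⊕ k))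
  frameCount≡∑sheared = begin
    (∑[ b₁ ] ∑[ b₂ ] ∑[ b₃ ] ∑[ x₂ ] ∑[ y₃ ] frame b₁ b₂ b₃ x₂ y₃)
      ≡⟨ ∑G-cong (λ b₁ → ∑G-cong λ b₂ → ∑G-cong λ b₃ → ∑G-cong λ x₂ →
                    sym (∑G-translateˡ b₃ _)) ⟩
    (∑[ b₁ ] ∑[ b₂ ] ∑[ b₃ ] ∑[ x₂ ] ∑[ k ] frame b₁ b₂ b₃ x₂ (b₃ ⊕ k))
      ≡⟨ ∑G-cong (λ b₁ → ∑G-cong λ b₂ → sym (∑G-translateˡ b₂ _)) ⟩
    (∑[ b₁ ] ∑[ b₂ ] ∑[ d ] ∑[ x₂ ] ∑[ k ] frame b₁ b₂ (b₂ ⊕ d) x₂ ((b₂ ⊕ d) ⊕ k))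
      ≡⟨ ∑G-cong (λ b₁ → ∑G-comm _) ⟩
    (∑[ b₁ ] ∑[ d ] ∑[ b₂ ] ∑[ x₂ ] ∑[ k ] frame b₁ b₂ (b₂ ⊕ d) x₂ ((b₂ ⊕ d) ⊕ k))
      ≡⟨ ∑G-comm _ ⟩
    (∑[ d ] ∑[ b₁ ] ∑[ b₂ ] ∑[ x₂ ] ∑[ k ] frame b₁ b₂ (b₂ ⊕ d) x₂ ((b₂ ⊕ d) ⊕ k))
      ≡⟨ ∑G-cong (λ d → sym (∑G-translateʳ d _)) ⟩
    (∑[ d ] ∑[ b' ] ∑[ b ] ∑[ x ] ∑[ k ] frame (b' ⊕ d) b (b ⊕ d) x ((b ⊕ d) ⊕ k))
      ≡⟨ ∑G-cong (λ d → ∑G-cong λ b' → ∑G-cong λ b → ∑G-comm _) ⟩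
    (∑[ d ] ∑[ b' ] ∑[ b ] ∑[ k ] ∑[ x ] frame (b' ⊕ d) b (b ⊕ d) x ((b ⊕ d) ⊕ k))
      ≡⟨ ∑G-cong (λ d → ∑G-cong λ b' → ∑G-comm _) ⟩
    (∑[ d ] ∑[ b' ] ∑[ k ] ∑[ b ] ∑[ x ] frame (b' ⊕ d) b (b ⊕ d) x ((b ⊕ d) ⊕ k))
      ≡⟨ ∑G-cong (λ d → ∑G-comm _) ⟩
    (∑[ d ] ∑[ k ] ∑[ b' ] ∑[ b ] ∑[ x ] frame (b' ⊕ d) b (b ⊕ d) x ((b ⊕ d) ⊕ k)) ∎
    where open ≡-Reasoning

  frameCount≡∑diffRep*triples² : frameCount ≡ (∑[ d ] diffRep d * ∑triples² d)
  frameCount≡∑diffRep*triples² = trans frameCount≡∑sheared (∑G-cong λ d →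
    trans (∑G-cong (factor d)) (∑-*ˡ elements (diffRep d) _))
    where
    open ≡-Reasoning
    factor : ∀ d k → (∑[ b' ] ∑[ b ] ∑[ x ] frame (b' ⊕ d) b (b ⊕ d) x ((b ⊕ d) ⊕ k)) ≡
                     diffRep d * (triples d k * triples d k)
    factor d k = begin
      (∑[ b' ] ∑[ b ] ∑[ x ] frame (b' ⊕ d) b (b ⊕ d) x ((b ⊕ d) ⊕ k))
        ≡⟨ ∑G-cong (λ b' → ∑G-cong λ b → ∑G-cong λ x → frame-shear d k b' b x) ⟩
      (∑[ b' ] ∑[ b ] ∑[ x ] χ x * χ (x ⊕ d) * (triple d k b' * triple d k b))
        ≡⟨ ∑G-cong (λ b' → ∑G-cong λ b → ∑-*ʳ elements _ _) ⟩
      (∑[ b' ] ∑[ b ] diffRep d * (triple d k b' * triple d k b))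
        ≡⟨ trans (∑G-cong (λ b' → ∑-*ˡ elements (diffRep d) _)) (∑-*ˡ elements (diffRep d) _) ⟩
      diffRep d * (∑[ b' ] ∑[ b ] triple d k b' * triple d k b)
        ≡⟨ cong (diffRep d *_) (∑-*-∑ elements elements (triple d k) (triple d k)) ⟩
      diffRep d * (triples d k * triples d k) ∎

  ∑diffRep² ∑diffRep³ : ℕ
  ∑diffRep² = ∑[ d ] diffRep d * diffRep d
  ∑diffRep³ = ∑[ d ] diffRep d * (diffRep d * diffRep d)

  a⁴≤N*∑diffRep² : a * a * (a * a) ≤ N * ∑diffRep²
  a⁴≤N*∑diffRep² =
    subst (λ s → s * s ≤ N * ∑diffRep²) ∑diffRep≡a*a (∑-square-≤ elements diffRep)

  [∑diffRep²]²≤a²*∑diffRep³ : ∑diffRep² * ∑diffRep² ≤ a * a * ∑diffRep³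
  [∑diffRep²]²≤a²*∑diffRep³ =
    subst (λ s → ∑diffRep² * ∑diffRep² ≤ s * ∑diffRep³)
          ∑diffRep≡a*a
    (∑-cauchy-schwarz elements (λ d → diffRep d * diffRep d) diffRep
                      (λ d → diffRep d * (diffRep d * diffRep d))
                      (λ d → ≤-reflexive (x²x²≡x[x·x²] (diffRep d))))
    where
    x²x²≡x[x·x²] : ∀ x → x * x * (x * x) ≡ x * (x * (x * x))
    x²x²≡x[x·x²] = solve-∀

  a²*∑diffRep³≤N*frameCount : a * a * ∑diffRep³ ≤ N * frameCount
  a²*∑diffRep³≤N*frameCount = begin
    a * a * ∑diffRep³
      ≡⟨ ∑-*ˡ elements (a * a) _ ⟨
    (∑[ d ] a * a * (diffRep d * (diffRep d * diffRep d)))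
      ≡⟨ ∑G-cong (λ d → regroup (diffRep d) a) ⟩
    (∑[ d ] diffRep d * (diffRep d * a * (diffRep d * a)))
      ≤⟨ ∑-mono-≤ elements (λ d → *-monoʳ-≤ (diffRep d) ([diffRep*a]²≤N*∑triples² d)) ⟩
    (∑[ d ] diffRep d * (N * ∑triples² d))
      ≡⟨ ∑G-cong (λ d → x*[y*z]≡y*[x*z] (diffRep d) N _) ⟩
    (∑[ d ] N * (diffRep d * ∑triples² d))
      ≡⟨ ∑-*ˡ elements N _ ⟩
    N * (∑[ d ] diffRep d * ∑triples² d)
      ≡⟨ cong (N *_) frameCount≡∑diffRep*triples² ⟨
    N * frameCount ∎
    where
    open ≤-Reasoning
    [diffRep*a]²≤N*∑triples² : ∀ d → diffRep d * a * (diffRep d * a) ≤ N * ∑triples² d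
    [diffRep*a]²≤N*∑triples² d = subst (λ s → s * s ≤ N * ∑triples² d)
                                   (∑triples≡diffRep*a d) (∑-square-≤ elements (triples d))
    regroup : ∀ r a → a * a * (r * (r * r)) ≡ r * (r * a * (r * a))
    regroup = solve-∀
    x*[y*z]≡y*[x*z] : ∀ x y z → x * (y * z) ≡ y * (x * z)
    x*[y*z]≡y*[x*z] = solve-∀

  a³²N⁶≤count*N³² : a ^ 32 * N ^ 6 ≤ count * N ^ 32
  a³²N⁶≤count*N³² =
    a³²N⁶≤M*N³² a≤N a⁴≤N*∑diffRep² [∑diffRep²]²≤a²*∑diffRep³
                a²*∑diffRep³≤N*frameCount frameCount²≤a⁴*count

[m%d+n]%d≡[m+n]%d : ∀ m n d .{{_ : NonZero d}} → (m % d + n) % d ≡ (m + n) % d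
[m%d+n]%d≡[m+n]%d m n d = begin
  (m % d + n) % d         ≡⟨ %-distribˡ-+ (m % d) n d ⟩
  (m % d % d + n % d) % d ≡⟨ cong (λ k → (k + n % d) % d) (m%n%n≡m%n m d) ⟩
  (m % d + n % d) % d     ≡⟨ %-distribˡ-+ m n d ⟨
  (m + n) % d ∎
  where open ≡-Reasoning

zipWith-cancelʳ : ∀ {A : Set} {f g : A → A → A} → (∀ x y → g (f x y) y ≡ x) →
                  ∀ {n} (xs ys : Vec A n) → zipWith g (zipWith f xs ys) ys ≡ xs
zipWith-cancelʳ cancel []       []       = refl
zipWith-cancelʳ cancel (x ∷ xs) (y ∷ ys) = cong₂ _∷_ (cancel x y) (zipWith-cancelʳ cancel xs ys)

if-∧ : ∀ b c → (if b ∧ c then 1 else 0) ≡ (if b then 1 else 0) * (if c then 1 else 0)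
if-∧ true  c = sym (*-identityˡ _)
if-∧ false c = refl

∑-tabulate-suc : ∀ {n} (f : Fin (suc n) → ℕ) → ∑ (tabulate suc) f ≡ ∑ (allFin n) (f ∘ suc)
∑-tabulate-suc f = cong sum (trans (map-tabulate suc f) (sym (map-tabulate (λ i → i) (f ∘ suc))))

allFin-enumerates : ∀ n → Enumerates Fin._≟_ (allFin n)
allFin-enumerates (suc n) zero    =
  cong suc (trans (∑-tabulate-suc {n} (δ Fin._≟_ zero)) (∑-zero (allFin n)))
allFin-enumerates (suc n) (suc x) =
  trans (∑-tabulate-suc {n} (δ Fin._≟_ (suc x))) (allFin-enumerates n x)

∑-allV-suc : ∀ p n (f : V p (suc n) → ℕ) →
             ∑ (allV p (suc n)) f ≡ ∑ (allFin p) (λ x → ∑ (allV p n) (λ xs → f (x ∷ xs)))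
∑-allV-suc p n f = trans (∑-concatMap (λ x → map (x ∷_) (allV p n)) (allFin p) f)
                         (∑-cong (allFin p) (λ x → ∑-map (x ∷_) (allV p n) f))

allV-enumerates : ∀ p n → Enumerates (≡-dec Fin._≟_) (allV p n)
allV-enumerates p zero    []       = refl
allV-enumerates p (suc n) (x ∷ xs) = begin
  ∑ (allV p (suc n)) (δᵥ (x ∷ xs))
    ≡⟨ ∑-allV-suc p n _ ⟩
  ∑ (allFin p) (λ y → ∑ (allV p n) (λ ys → δᵥ (x ∷ xs) (y ∷ ys)))
    ≡⟨ ∑-cong (allFin p) factor ⟩
  ∑ (allFin p) (λ y → δ Fin._≟_ x y * 1)
    ≡⟨ ∑-cong (allFin p) (λ y → *-identityʳ _) ⟩
  ∑ (allFin p) (δ Fin._≟_ x)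
    ≡⟨ allFin-enumerates p x ⟩
  1 ∎
  where
  open ≡-Reasoning
  δᵥ : ∀ {n} → V p n → V p n → ℕ
  δᵥ = δ (≡-dec Fin._≟_)
  factor : ∀ y → ∑ (allV p n) (λ ys → δᵥ (x ∷ xs) (y ∷ ys)) ≡ δ Fin._≟_ x y * 1
  factor y = begin
    ∑ (allV p n) (λ ys → δᵥ (x ∷ xs) (y ∷ ys))
      ≡⟨ ∑-cong (allV p n) (λ ys → if-∧ (does (x Fin.≟ y)) (does (≡-dec Fin._≟_ xs ys))) ⟩
    ∑ (allV p n) (λ ys → δ Fin._≟_ x y * δᵥ xs ys)
      ≡⟨ ∑-*ˡ (allV p n) (δ Fin._≟_ x y) (δᵥ xs) ⟩
    δ Fin._≟_ x y * ∑ (allV p n) (δᵥ xs)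
      ≡⟨ cong (δ Fin._≟_ x y *_) (allV-enumerates p n xs) ⟩
    δ Fin._≟_ x y * 1 ∎

∑-allV-1≡p^n : ∀ p n → ∑ (allV p n) (λ _ → 1) ≡ p ^ n
∑-allV-1≡p^n p zero    = refl
∑-allV-1≡p^n p (suc n) = begin
  ∑ (allV p (suc n)) (λ _ → 1)                ≡⟨ ∑-allV-suc p n _ ⟩
  ∑ (allFin p) (λ _ → ∑ (allV p n) (λ _ → 1)) ≡⟨ ∑-cong (allFin p) (λ _ → ∑-allV-1≡p^n p n) ⟩
  ∑ (allFin p) (λ _ → p ^ n)                  ≡⟨ ∑-const (allFin p) (p ^ n) ⟩
  length (allFin p) * p ^ n                   ≡⟨ cong (_* p ^ n) (length-tabulate {n = p} (λ i → i)) ⟩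
  p * p ^ n ∎
  where open ≡-Reasoning

module _ {p : ℕ} (pr : Prime p) where

  private
    instance
      p≢0 : NonZero p
      p≢0 = prime⇒nonZero pr

  _+ₚ_ _-ₚ_ : Fin p → Fin p → Fin p
  _+ₚ_ = _+F_ pr
  _-ₚ_ = _-F_ pr

  mod≡ : ∀ {m} {x : Fin p} → m % p ≡ toℕ x → m mod p ≡ x
  mod≡ {m} m%p≡x = Fin.toℕ-injective (trans (Fin.toℕ-fromℕ< (m%n<n m p)) m%p≡x)

  toℕ-mod+ : ∀ m n → (toℕ (m mod p) + n) % p ≡ (m + n) % p
  toℕ-mod+ m n =
    trans (cong (λ k → (k + n) % p) (Fin.toℕ-fromℕ< (m%n<n m p))) ([m%d+n]%d≡[m+n]%d m n p)

  +toℕ-mod : ∀ m n → (m + toℕ (n mod p)) % p ≡ (m + n) % p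
  +toℕ-mod m n = begin
    (m + toℕ (n mod p)) % p ≡⟨ cong (_% p) (+-comm m _) ⟩
    (toℕ (n mod p) + m) % p ≡⟨ toℕ-mod+ n m ⟩
    (n + m) % p             ≡⟨ cong (_% p) (+-comm n m) ⟩
    (m + n) % p ∎
    where open ≡-Reasoning

  +ₚ-comm : ∀ x y → x +ₚ y ≡ y +ₚ x
  +ₚ-comm x y = cong (_mod p) (+-comm (toℕ x) (toℕ y))

  +ₚ-assoc : ∀ x y z → (x +ₚ y) +ₚ z ≡ x +ₚ (y +ₚ z)
  +ₚ-assoc x y z = mod≡ (begin
    (toℕ (x +ₚ y) + toℕ z) % p    ≡⟨ toℕ-mod+ (toℕ x + toℕ y) (toℕ z) ⟩
    (toℕ x + toℕ y + toℕ z) % p   ≡⟨ cong (_% p) (+-assoc (toℕ x) (toℕ y) (toℕ z)) ⟩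
    (toℕ x + (toℕ y + toℕ z)) % p ≡⟨ +toℕ-mod (toℕ x) (toℕ y + toℕ z) ⟨
    (toℕ x + toℕ (y +ₚ z)) % p    ≡⟨ Fin.toℕ-fromℕ< (m%n<n _ p) ⟨
    toℕ (x +ₚ (y +ₚ z)) ∎)
    where open ≡-Reasoning

  [x+p]%p≡x : ∀ (x : Fin p) → (toℕ x + p) % p ≡ toℕ x
  [x+p]%p≡x x = trans ([m+n]%n≡m%n (toℕ x) p) (m<n⇒m%n≡m (Fin.toℕ<n x))

  x+ₚy-ₚy≡x : ∀ x y → (x +ₚ y) -ₚ y ≡ x
  x+ₚy-ₚy≡x x y = mod≡ (begin
    (toℕ (x +ₚ y) + (p ∸ toℕ y)) % p
      ≡⟨ toℕ-mod+ (toℕ x + toℕ y) (p ∸ toℕ y) ⟩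
    (toℕ x + toℕ y + (p ∸ toℕ y)) % p
      ≡⟨ cong (_% p) (+-assoc (toℕ x) (toℕ y) (p ∸ toℕ y)) ⟩
    (toℕ x + (toℕ y + (p ∸ toℕ y))) % p
      ≡⟨ cong (λ k → (toℕ x + k) % p) (m+[n∸m]≡n (<⇒≤ (Fin.toℕ<n y))) ⟩
    (toℕ x + p) % p
      ≡⟨ [x+p]%p≡x x ⟩
    toℕ x ∎)
    where open ≡-Reasoning

  x-ₚy+ₚy≡x : ∀ x y → (x -ₚ y) +ₚ y ≡ x
  x-ₚy+ₚy≡x x y = mod≡ (begin
    (toℕ (x -ₚ y) + toℕ y) % p
      ≡⟨ toℕ-mod+ (toℕ x + (p ∸ toℕ y)) (toℕ y) ⟩
    (toℕ x + (p ∸ toℕ y) + toℕ y) % p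
      ≡⟨ cong (_% p) (+-assoc (toℕ x) (p ∸ toℕ y) (toℕ y)) ⟩
    (toℕ x + (p ∸ toℕ y + toℕ y)) % p
      ≡⟨ cong (λ k → (toℕ x + k) % p) (m∸n+n≡m (<⇒≤ (Fin.toℕ<n y))) ⟩
    (toℕ x + p) % p
      ≡⟨ [x+p]%p≡x x ⟩
    toℕ x ∎)
    where open ≡-Reasoning

  ⊕-comm : ∀ {n} (x y : V p n) → _⊕_ pr x y ≡ _⊕_ pr y x
  ⊕-comm x y = Pointwise-≡⇒≡ (zipWith-comm +ₚ-comm x y)

  ⊕-assoc : ∀ {n} (x y z : V p n) → _⊕_ pr (_⊕_ pr x y) z ≡ _⊕_ pr x (_⊕_ pr y z)
  ⊕-assoc x y z = Pointwise-≡⇒≡ (zipWith-assoc +ₚ-assoc x y z)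

  x⊕y⊖y≡x : ∀ {n} (x y : V p n) → _⊖_ pr (_⊕_ pr x y) y ≡ x
  x⊕y⊖y≡x = zipWith-cancelʳ x+ₚy-ₚy≡x

  x⊖y⊕y≡x : ∀ {n} (x y : V p n) → _⊕_ pr (_⊖_ pr x y) y ≡ x
  x⊖y⊕y≡x = zipWith-cancelʳ x-ₚy+ₚy≡x

length-filter≡∑ : (A : X → Bool) (xs : List X) →
                  length (filter (λ x → A x Bool.≟ true) xs) ≡ ∑ xs (λ x → if A x then 1 else 0)
length-filter≡∑ A []       = refl
length-filter≡∑ A (x ∷ xs) with A x
... | true  = cong suc (length-filter≡∑ A xs)
... | false = length-filter≡∑ A xs

toℚᵘ-/ : ∀ m d .{{_ : NonZero d}} → toℚᵘ (m ℚ./ d) ≃ m ᵘ/ d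
toℚᵘ-/ m (suc d) = toℚᵘ-fromℚᵘ (mkℚᵘ m d)

ᵘ/-*-ᵘ/ : ∀ m n d e .{{_ : NonZero d}} .{{_ : NonZero e}} →
          (ℤ.+ m ᵘ/ d) ᵘ* (ℤ.+ n ᵘ/ e) ≃ (ℤ.+ (m * n) ᵘ/ (d * e)) {{m*n≢0 d e}}
ᵘ/-*-ᵘ/ m n (suc d) (suc e) =
  ≃-reflexive (cong (λ k → mkℚᵘ k (pred (suc d * suc e))) (sym (pos-* m n)))

toℚᵘ-[m/d]^k : ∀ m d k .{{_ : NonZero d}} →
               toℚᵘ ((ℤ.+ m ℚ./ d) ^ℚ k) ≃ (ℤ.+ (m ^ k) ᵘ/ (d ^ k)) {{m^n≢0 d k}}
toℚᵘ-[m/d]^k m d zero    = ≃-refl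
toℚᵘ-[m/d]^k m d (suc k) = ≃-trans (toℚᵘ-homo-* (ℤ.+ m ℚ./ d) ((ℤ.+ m ℚ./ d) ^ℚ k))
  (≃-trans (ᵘ*-cong (toℚᵘ-/ (ℤ.+ m) d) (toℚᵘ-[m/d]^k m d k))
           (ᵘ/-*-ᵘ/ m (m ^ k) d (d ^ k) {{_}} {{m^n≢0 d k}}))

ᵘ/≤ᵘ/ : ∀ m n d e .{{_ : NonZero d}} .{{_ : NonZero e}} →
        m * e ≤ n * d → ℤ.+ m ᵘ/ d ≤ᵘ ℤ.+ n ᵘ/ e
ᵘ/≤ᵘ/ m n (suc d) (suc e) me≤nd =
  *≤* (subst₂ ℤ._≤_ (pos-* m (suc e)) (pos-* n (suc d)) (+≤+ me≤nd))

[m/d]^k≤n/e : ∀ k m n d e .{{_ : NonZero d}} .{{_ : NonZero e}} →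
              m ^ k * e ≤ n * d ^ k → (ℤ.+ m ℚ./ d) ^ℚ k ℚ.≤ ℤ.+ n ℚ./ e
[m/d]^k≤n/e k m n d e mᵏe≤ndᵏ = toℚᵘ-cancel-≤
  (≤-respˡ-≃ (≃-sym (toℚᵘ-[m/d]^k m d k))
    (≤-respʳ-≃ (≃-sym (toℚᵘ-/ (ℤ.+ n) e))
      (ᵘ/≤ᵘ/ (m ^ k) n (d ^ k) e {{m^n≢0 d k}} mᵏe≤ndᵏ)))

lemma2p4 : (p : ℕ) (pr : Prime p) (n : ℕ) (A : V p n → Bool) →
           (density pr n A ^ℚ 32) ℚ.≤ expectation pr n A
lemma2p4 p pr n A =
  [m/d]^k≤n/e 32 (cardA pr A) (countConfig pr n A) (p ^ n) ((p ^ n) ^ 6)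
              {{m^n≢0 p n}} {{m^n≢0 (p ^ n) 6 {{m^n≢0 p n}}}}
  (subst₂ (λ a N → a ^ 32 * N ^ 6 ≤ count * N ^ 32)
          (sym (length-filter≡∑ A (allV p n))) (∑-allV-1≡p^n p n) a³²N⁶≤count*N³²)
  where
  instance _ = prime⇒nonZero pr
  open Configurations (≡-dec Fin._≟_) (allV p n) (allV-enumerates p n)
         (_⊕_ pr) (_⊖_ pr) (⊕-comm pr) (⊕-assoc pr) (x⊕y⊖y≡x pr) (x⊖y⊕y≡x pr) A
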